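{- Let $l$ be a positive odd integer and let $n$ be a positive integer with $n>\sqrt{l/2}$ such that $P_{2,l}(n)=\prod_{k=1}^n(2k^2+l)$ is a perfect square. If $p$ is a prime divisor of $P_{2,l}(n)$, then $p<2n$. -}

module Defs where

open import Data.Nat using (ℕ; zero; suc; _+_; _*_)

P₂ : ℕ → ℕ → ℕ
P₂ l zero    = 1
P₂ l (suc n) = P₂ l n * (2 * (suc n * suc n) + l)

{-# OPTIONS --safe #-}
-- Suppose a prime p ≥ 2n divides the square P₂(n) = ∏_{k ≤ n} (2k² + l); then p² divides it.
-- Since 2k'² + l − (2k² + l) = 2(k' − k)(k' + k) and p is odd, p cannot divide two of the
-- factors with k < k' ≤ n, as 0 < k' − k, k' + k < 2n ≤ p. So p² divides a single factor,
-- whereas every factor is at most 2n² + l < 4n² ≤ p².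
module Submission where

open import Defs
open import Data.Nat using (ℕ; zero; suc; _+_; _*_; _<_; _≤_; _<?_; s≤s; nonTrivial⇒n>1; >-nonZero)
open import Data.Nat.Properties
open import Data.Nat.Divisibility
open import Data.Nat.Primality using (Prime; euclidsLemma; prime⇒nonZero; prime⇒nonTrivial)
open import Data.Nat.Solver using (module +-*-Solver)
open import Data.Empty using (⊥-elim)
open import Data.Product using (∃-syntax; ∃₂; _×_; _,_)
open import Data.Sum using (_⊎_; inj₁; inj₂; [_,_])
open import Function using (id)
open import Relation.Nullary using (¬_; yes; no; contradiction)
open import Relation.Binary.PropositionalEquality using (_≡_; refl; sym; cong; subst)

open +-*-Solver

private
  variable
    l n p : ℕ

prime∤1 : Prime p → ¬ p ∣ 1
prime∤1 {p} pp p∣1 = <-irrefl (sym (∣1⇒≡1 p∣1)) (nonTrivial⇒n>1 p {{prime⇒nonTrivial pp}})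

prime∣square⇒prime²∣square : ∀ {m} → Prime p → p ∣ m * m → p * p ∣ m * m
prime∣square⇒prime²∣square {p} {m} pp p∣m² = *-pres-∣ p∣m p∣m
  where
  p∣m : p ∣ m
  p∣m = [ id , id ] (euclidsLemma m m pp p∣m²)

prime²∣m*n∧∤m⇒prime²∣n : ∀ m n → Prime p → p * p ∣ m * n → ¬ p ∣ m → p * p ∣ n
prime²∣m*n∧∤m⇒prime²∣n {p} m n pp p²∣mn p∤m
  with euclidsLemma m n pp (∣-trans (m∣m*n p) p²∣mn)
... | inj₁ p∣m = contradiction p∣m p∤m
... | inj₂ (divides q refl) = *-monoˡ-∣ p p∣q
  where
  instance _ = prime⇒nonZero pp
  p∣m*q : p ∣ m * q
  p∣m*q = *-cancelʳ-∣ p (subst (p * p ∣_) (sym (*-assoc m q p)) p²∣mn)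
  p∣q : p ∣ q
  p∣q = [ (λ p∣m → contradiction p∣m p∤m) , id ] (euclidsLemma m q pp p∣m*q)

∣2∧∣odd⇒∣1 : ∀ {d m} → d ∣ 2 → d ∣ 2 * m + 1 → d ∣ 1
∣2∧∣odd⇒∣1 {m = m} d∣2 d∣2m+1 = ∣m+n∣m⇒∣n d∣2m+1 (∣m⇒∣m*n m d∣2)

P₂-factor : ℕ → ℕ → ℕ
P₂-factor l k = 2 * (k * k) + l

P₂-factor-odd : ∀ j k → P₂-factor (2 * j + 1) k ≡ 2 * (k * k + j) + 1
P₂-factor-odd = solve 2 (λ j k → con 2 :* (k :* k) :+ (con 2 :* j :+ con 1)
                                := con 2 :* (k :* k :+ j) :+ con 1) refl

P₂-factor-difference : ∀ l k o →
  P₂-factor l (suc (k + o)) ≡ P₂-factor l k + 2 * (suc o * (suc (k + o) + k))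
P₂-factor-difference = solve 3 (λ l k o →
    con 2 :* ((con 1 :+ k :+ o) :* (con 1 :+ k :+ o)) :+ l
  := con 2 :* (k :* k) :+ l :+ con 2 :* ((con 1 :+ o) :* ((con 1 :+ k :+ o) :+ k))) refl

P₂-factor-mono-≤ : ∀ l {k n} → k ≤ n → P₂-factor l k ≤ P₂-factor l n
P₂-factor-mono-≤ l k≤n = +-monoˡ-≤ l (*-monoʳ-≤ 2 (*-mono-≤ k≤n k≤n))

prime∣P₂⇒prime∣P₂-factor : ∀ n → Prime p → p ∣ P₂ l n → ∃[ k ] (k ≤ n × p ∣ P₂-factor l k)
prime∣P₂⇒prime∣P₂-factor zero pp p∣1 = contradiction p∣1 (prime∤1 pp)
prime∣P₂⇒prime∣P₂-factor {l = l} (suc n) pp p∣P with euclidsLemma (P₂ l n) _ pp p∣P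
... | inj₂ p∣factor = suc n , ≤-refl , p∣factor
... | inj₁ p∣P′ with prime∣P₂⇒prime∣P₂-factor n pp p∣P′
...   | k , k≤n , p∣factor = k , m≤n⇒m≤1+n k≤n , p∣factor

prime∣two-P₂-factors⇒≤ : ∃[ j ] l ≡ 2 * j + 1 → Prime p → ∀ {k k'} → k < k'
  → p ∣ P₂-factor l k → p ∣ P₂-factor l k' → p ≤ k + k'
prime∣two-P₂-factors⇒≤ {p = p} (j , refl) pp {k} k<k' p∣fk p∣fk'
  with m≤n⇒∃[o]m+o≡n k<k'
... | o , refl with euclidsLemma 2 _ pp p∣difference
  where
  p∣difference : p ∣ 2 * (suc o * (suc (k + o) + k))
  p∣difference = ∣m+n∣m⇒∣n (subst (p ∣_) (P₂-factor-difference _ k o) p∣fk') p∣fk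
... | inj₁ p∣2 = contradiction (∣2∧∣odd⇒∣1 {m = k * k + j} p∣2 (subst (p ∣_) (P₂-factor-odd j k) p∣fk)) (prime∤1 pp)
... | inj₂ p∣product with euclidsLemma (suc o) _ pp p∣product
...   | inj₁ p∣1+o = ≤-trans (∣⇒≤ p∣1+o) (≤-trans (s≤s (m≤n+m o k)) (m≤n+m (suc (k + o)) k))
...   | inj₂ p∣sum = subst (p ≤_) (+-comm (suc (k + o)) k) (∣⇒≤ p∣sum)

PrimeSquareDividesP₂-factor : ℕ → ℕ → ℕ → Set
PrimeSquareDividesP₂-factor l n p = ∃[ k ] (k ≤ n × p * p ∣ P₂-factor l k)

PrimeDividesTwoP₂-factors : ℕ → ℕ → ℕ → Set
PrimeDividesTwoP₂-factors l n p =
  ∃₂ λ k k' → k < k' × k' ≤ n × p ∣ P₂-factor l k × p ∣ P₂-factor l k'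

widen : PrimeSquareDividesP₂-factor l n p ⊎ PrimeDividesTwoP₂-factors l n p
      → PrimeSquareDividesP₂-factor l (suc n) p ⊎ PrimeDividesTwoP₂-factors l (suc n) p
widen (inj₁ (k , k≤n , p²∣fk)) = inj₁ (k , m≤n⇒m≤1+n k≤n , p²∣fk)
widen (inj₂ (k , k' , k<k' , k'≤n , p∣fk , p∣fk')) =
  inj₂ (k , k' , k<k' , m≤n⇒m≤1+n k'≤n , p∣fk , p∣fk')

prime²∣P₂⇒one⊎two-factors : ∀ n → Prime p → p * p ∣ P₂ l n
  → PrimeSquareDividesP₂-factor l n p ⊎ PrimeDividesTwoP₂-factors l n p
prime²∣P₂⇒one⊎two-factors {p} zero pp p²∣1 = contradiction (∣-trans (m∣m*n p) p²∣1) (prime∤1 pp)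
prime²∣P₂⇒one⊎two-factors {p} {l} (suc n) pp p²∣P with p ∣? P₂ l n | p ∣? P₂-factor l (suc n)
... | no p∤P | _ = inj₁ (suc n , ≤-refl , prime²∣m*n∧∤m⇒prime²∣n (P₂ l n) _ pp p²∣P p∤P)
... | yes p∣P | yes p∣f with prime∣P₂⇒prime∣P₂-factor n pp p∣P
...   | k , k≤n , p∣fk = inj₂ (k , suc n , s≤s k≤n , ≤-refl , p∣fk , p∣f)
prime²∣P₂⇒one⊎two-factors {p} {l} (suc n) pp p²∣P | yes _ | no p∤f =
  widen (prime²∣P₂⇒one⊎two-factors n pp (prime²∣m*n∧∤m⇒prime²∣n _ (P₂ l n) pp p²∣f*P p∤f))
  where
  p²∣f*P : p * p ∣ P₂-factor l (suc n) * P₂ l n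
  p²∣f*P = subst (p * p ∣_) (*-comm (P₂ l n) _) p²∣P

P₂-factor<[2n]² : l < 2 * (n * n) → P₂-factor l n < (2 * n) * (2 * n)
P₂-factor<[2n]² {l} {n} l<2n² = begin-strict
  2 * (n * n) + l             <⟨ +-monoʳ-< (2 * (n * n)) l<2n² ⟩
  2 * (n * n) + 2 * (n * n)   ≡⟨ solve 1 (λ n → con 2 :* (n :* n) :+ con 2 :* (n :* n)
                                             := (con 2 :* n) :* (con 2 :* n)) refl n ⟩
  (2 * n) * (2 * n)           ∎
  where open ≤-Reasoning

lemma4 : (l n : ℕ) → 0 < l → ∃[ j ] l ≡ 2 * j + 1 → 0 < n → l < 2 * (n * n)
    → ∃[ m ] P₂ l n ≡ m * m
    → (p : ℕ) → Prime p → p ∣ P₂ l n → p < 2 * n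
lemma4 l n 0<l odd _ l<2n² (m , P≡m²) p pp p∣P with p <? 2 * n
... | yes p<2n = p<2n
... | no p≮2n = ⊥-elim ([ square-in-one-factor , two-factors ] (prime²∣P₂⇒one⊎two-factors n pp p²∣P))
  where
  2n≤p : 2 * n ≤ p
  2n≤p = ≮⇒≥ p≮2n

  p²∣P : p * p ∣ P₂ l n
  p²∣P = subst (p * p ∣_) (sym P≡m²) (prime∣square⇒prime²∣square {m = m} pp (subst (p ∣_) P≡m² p∣P))

  square-in-one-factor : ¬ PrimeSquareDividesP₂-factor l n p
  square-in-one-factor (k , k≤n , p²∣fk) = <⇒≱ (P₂-factor<[2n]² {n = n} l<2n²) (begin
    (2 * n) * (2 * n)  ≤⟨ *-mono-≤ 2n≤p 2n≤p ⟩
    p * p              ≤⟨ ∣⇒≤ {{>-nonZero (<-≤-trans 0<l (m≤n+m l _))}} p²∣fk ⟩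
    P₂-factor l k      ≤⟨ P₂-factor-mono-≤ l k≤n ⟩
    P₂-factor l n      ∎)
    where open ≤-Reasoning

  two-factors : ¬ PrimeDividesTwoP₂-factors l n p
  two-factors (k , k' , k<k' , k'≤n , p∣fk , p∣fk') = <⇒≱ (begin-strict
    k + k'     <⟨ +-mono-<-≤ (<-≤-trans k<k' k'≤n) k'≤n ⟩
    n + n      ≡⟨ cong (n +_) (sym (+-identityʳ n)) ⟩
    2 * n      ≤⟨ 2n≤p ⟩
    p          ∎) (prime∣two-P₂-factors⇒≤ odd pp k<k' p∣fk p∣fk')
    where open ≤-Reasoning
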